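{- Let $G_{\mathrm{cov}}=(R\uplus B,E')$ be a bipartite graph, $k\ge1$ an integer, $t\ge0$, $\varepsilon>0$, and let $P\subseteq R$ be arbitrary. Let $G_{\mathrm{conf}}$, $G^{\mathrm{purple}}$, $G_{\mathrm{spar}}$ and $w$ be as defined in the context. Then for every $Y\subseteq V(G^{\mathrm{purple}})$ with $|Y|\le k$, $$|N_{G_{\mathrm{cov}}}(Y)|\ \ge\ |N_{G_{\mathrm{spar}}}(Y)|\ \ge\ \sum_{y\in Y}w(y)-\varepsilon t.$$
   Context: The conflict graph $G_{\mathrm{conf}}$ has vertex set $R$, with $uv$ an edge iff $u\ne v$ and $|N_{G_{\mathrm{cov}}}(u)\cap N_{G_{\mathrm{cov}}}(v)|\ge \varepsilon t/k^2$. $G^{\mathrm{purple}}$ is obtained from $G_{\mathrm{conf}}[P]$ by deleting every connected component with more than $k$ vertices; let $C_1,\dots,C_s$ be its connected components. The sparsified graph $G_{\mathrm{spar}}$ is the bipartite subgraph of $G_{\mathrm{cov}}$ with vertex set $V(G^{\mathrm{purple}})\uplus B$ whose edges are obtained as follows: for every $b\in B$ and every $i\in[s]$ such that $b$ has at least one $G_{\mathrm{cov}}$-neighbour in $C_i$, exactly one (arbitrarily chosen) edge $xb\in E'$ with $x\in V(C_i)$ is included; no other edges are included. The weight of $v\in V(G^{\mathrm{purple}})$ is $w(v)=\deg_{G_{\mathrm{spar}}}(v)$.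
   Formalization: The parameters $t$ and $\varepsilon$ are rational numbers. -}

module Defs where

open import Data.Nat using (ℕ; zero; suc; NonZero) renaming (_+_ to _+ℕ_; _*_ to _*ℕ_)
open import Data.Nat.Properties using (m*n≢0)
open import Data.Integer using (+_)
open import Data.Rational using (ℚ; _≤_; _/_; _*_)
open import Data.Fin using (Fin) renaming (zero to fz; suc to fs)
open import Data.Bool using (Bool; true; false; if_then_else_)
open import Data.Product using (Σ; _×_; ∃; ∃-syntax)
open import Relation.Binary.PropositionalEquality using (_≡_; _≢_)
open import Relation.Nullary using (¬_)
open import Function.Definitions using (Injective)

count : ∀ {n} → (Fin n → Bool) → ℕ
count {zero}  p = 0
count {suc n} p = (if p fz then 1 else 0) +ℕ count {n} (λ i → p (fs i))

sumOver : ∀ {n} → (Fin n → Bool) → (Fin n → ℕ) → ℕ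
sumOver {zero}  p f = 0
sumOver {suc n} p f =
  (if p fz then f fz else 0) +ℕ sumOver {n} (λ i → p (fs i)) (λ i → f (fs i))

open import Data.Bool using (_∧_; _∨_)

-- A bipartite graph G_cov = (R ⊎ B, E') with R = Fin r, B = Fin b is given by
-- a Boolean adjacency  E : Fin r → Fin b → Bool  (E x y ≡ true iff xy ∈ E').

commonNbrs : ∀ {r b} → (Fin r → Fin b → Bool) → Fin r → Fin r → ℕ
commonNbrs E u v = count (λ y → E u y ∧ E v y)

ofℕ : ℕ → ℚ
ofℕ n = (+ n) / 1

threshold : (ε t : ℚ) (k : ℕ) → .{{NonZero k}} → ℚ
threshold ε t k = ε * t * ((+ 1) / (k *ℕ k))
  where instance _ = m*n≢0 k k

ConfEdge : ∀ {r b} → (Fin r → Fin b → Bool) → (ε t : ℚ) (k : ℕ) → .{{NonZero k}} →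
           Fin r → Fin r → Set
ConfEdge E ε t k u v = u ≢ v × threshold ε t k ≤ ofℕ (commonNbrs E u v)

data SameComp {r b} (E : Fin r → Fin b → Bool) (ε t : ℚ) (k : ℕ) .{{_ : NonZero k}}
              (P : Fin r → Bool) : Fin r → Fin r → Set where
  here : ∀ {u} → P u ≡ true → SameComp E ε t k P u u
  step : ∀ {u v w} → SameComp E ε t k P u v → P w ≡ true → ConfEdge E ε t k v w →
         SameComp E ε t k P u w

-- v ∈ V(G^purple): v ∈ P and the component of v in G_conf[P] has at most k
-- vertices, i.e. there are no k+1 distinct vertices in that component.
Purple : ∀ {r b} → (Fin r → Fin b → Bool) → (ε t : ℚ) (k : ℕ) → .{{NonZero k}} →
         (Fin r → Bool) → Fin r → Set
Purple {r} E ε t k P v =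
  P v ≡ true ×
  ¬ (Σ (Fin (suc k) → Fin r) λ f → Injective _≡_ _≡_ f × (∀ i → SameComp E ε t k P v (f i)))

-- S is a sparsified graph G_spar as in the construction (for some arbitrary choice
-- of the edges): S ⊆ E', every edge of S has its R-endpoint in V(G^purple), and for
-- every y ∈ B and every component C_i of G^purple in which y has a G_cov-neighbour,
-- S contains exactly one edge xy with x ∈ C_i.
IsSpar : ∀ {r b} → (Fin r → Fin b → Bool) → (ε t : ℚ) (k : ℕ) → .{{NonZero k}} →
         (Fin r → Bool) → (Fin r → Fin b → Bool) → Set
IsSpar {r} {b} E ε t k P S =
  (∀ x y → S x y ≡ true → E x y ≡ true) ×
  (∀ x y → S x y ≡ true → Purple E ε t k P x) ×
  (∀ (y : Fin b) (c : Fin r) → Purple E ε t k P c →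
     (∃[ x ] (SameComp E ε t k P c x × E x y ≡ true)) →
     (∃[ x ] (SameComp E ε t k P c x × S x y ≡ true)) ×
     (∀ x x' → SameComp E ε t k P c x → SameComp E ε t k P c x' →
        S x y ≡ true → S x' y ≡ true → x ≡ x'))

nbhdSize : ∀ {r b} → (Fin r → Fin b → Bool) → (Fin r → Bool) → ℕ
nbhdSize {r} E Y = count (λ y → anyR (λ x → Y x ∧ E x y))
  where
    anyR : ∀ {n} → (Fin n → Bool) → Bool
    anyR {zero} p = false
    anyR {suc n} p = p fz ∨ anyR (λ i → p (fs i))

deg : ∀ {r b} → (Fin r → Fin b → Bool) → Fin r → ℕ
deg S x = count (S x)

{-# OPTIONS --safe #-}
module Submission where

-- Truncated inclusion–exclusion: adding a vertex x to Y raises Σ deg by deg x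
-- and |N(Y)| by at least deg x minus the overlaps of N(x) with the neighbourhoods
-- already present, so Σ_{y∈Y} w(y) ≤ |N_spar(Y)| + |Y|² c whenever c bounds the
-- pairwise overlaps. Two distinct vertices share at most ε t / k² neighbours in
-- G_spar: if they are adjacent in G_conf they lie in one component of G^purple,
-- where G_spar keeps at most one edge at each b ∈ B, and otherwise they share
-- fewer than ε t / k² neighbours already in G_cov. As |Y|² ≤ k², the overlaps
-- total at most ε t.

open import Defs
open import Data.Nat using (ℕ; NonZero)
open import Data.Rational using (ℚ; _-_; _*_) renaming (_≤_ to _≤ℚ_; _<_ to _<ℚ_; 0ℚ to 0ℚ)
open import Data.Nat using (_≤_; _≥_)
open import Data.Fin using (Fin)
open import Data.Bool using (Bool; true)
open import Data.Product using (_×_)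
open import Relation.Binary.PropositionalEquality using (_≡_)

open import Data.Nat using (zero; suc; z≤n; _+_; _⊔_) renaming (_*_ to _*ℕ_)
open import Data.Nat.Properties
  using (≤-refl; ≤-trans; ≤-reflexive; +-identityʳ; +-assoc; +-suc; *-assoc; m≤m+n; m≤n+m;
         +-mono-≤; +-monoˡ-≤; +-monoʳ-≤; *-mono-≤; *-monoˡ-≤; *-monoʳ-≤; m*n≢0;
         ⊔-sel; m≤m⊔n; m≤n⊔m; module ≤-Reasoning)
import Data.Nat.Coprimality as Coprime
open import Data.Integer as ℤ using (+_)
import Data.Integer.Properties as ℤ
open import Data.Rational as ℚ using (mkℚ; 1ℚ; NonNegative) renaming (_+_ to _+ℚ_)
import Data.Rational.Properties as ℚ
open import Data.Fin using () renaming (zero to fz; suc to fs)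
open import Data.Fin.Properties using (suc-injective; _≟_)
open import Data.Bool using (false; _∧_; _∨_; if_then_else_)
open import Data.Bool.Properties using (∧-distribˡ-∨)
open import Data.Product using (_,_; proj₁; proj₂)
open import Data.Sum using (inj₁; inj₂)
open import Data.Empty using (⊥-elim)
open import Function using (_∘_)
open import Relation.Nullary using (yes; no; does)
open import Relation.Nullary.Decidable using (dec-false)
open import Relation.Binary.PropositionalEquality
  using (_≢_; refl; sym; trans; cong; cong₂; subst; module ≡-Reasoning)

ofℕ≡mkℚ : ∀ n → ofℕ n ≡ mkℚ (+ n) 0 (Coprime.sym (Coprime.1-coprimeTo n))
ofℕ≡mkℚ n = ℚ.normalize-coprime (Coprime.sym (Coprime.1-coprimeTo n))

ofℕ-+ : ∀ m n → ofℕ (m + n) ≡ ofℕ m +ℚ ofℕ n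
ofℕ-+ m n = begin
  ofℕ (m + n)                            ≡⟨ cong (ℚ._/ 1) numerator ⟩
  (+ m ℤ.* + 1 ℤ.+ + n ℤ.* + 1) ℚ./ 1    ≡⟨ cong₂ _+ℚ_ (ofℕ≡mkℚ m) (ofℕ≡mkℚ n) ⟨
  ofℕ m +ℚ ofℕ n                         ∎
  where
  open ≡-Reasoning
  numerator : + (m + n) ≡ + m ℤ.* + 1 ℤ.+ + n ℤ.* + 1
  numerator = trans (ℤ.pos-+ m n)
                    (sym (cong₂ ℤ._+_ (ℤ.*-identityʳ (+ m)) (ℤ.*-identityʳ (+ n))))

ofℕ-* : ∀ m n → ofℕ (m *ℕ n) ≡ ofℕ m * ofℕ n
ofℕ-* m n = begin
  ofℕ (m *ℕ n)             ≡⟨ cong (ℚ._/ 1) (ℤ.pos-* m n) ⟩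
  (+ m ℤ.* + n) ℚ./ 1      ≡⟨ cong₂ _*_ (ofℕ≡mkℚ m) (ofℕ≡mkℚ n) ⟨
  ofℕ m * ofℕ n            ∎
  where open ≡-Reasoning

ofℕ-mono-≤ : ∀ {m n} → m ≤ n → ofℕ m ≤ℚ ofℕ n
ofℕ-mono-≤ {m} {n} m≤n rewrite ofℕ≡mkℚ m | ofℕ≡mkℚ n =
  ℚ.*≤* (ℤ.*-monoʳ-≤-nonNeg (+ 1) (ℤ.+≤+ m≤n))

ofℕ*1/n≡1 : ∀ n .{{_ : NonZero n}} → ofℕ n * ((+ 1) ℚ./ n) ≡ 1ℚ
ofℕ*1/n≡1 (suc m)
  rewrite ofℕ≡mkℚ (suc m) | ℚ.normalize-coprime (Coprime.1-coprimeTo (suc m)) =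
  ℚ.*-inverseʳ (mkℚ (+ suc m) 0 (Coprime.sym (Coprime.1-coprimeTo (suc m))))

p≤q+r⇒p-r≤q : ∀ {p q r} → p ≤ℚ q +ℚ r → p - r ≤ℚ q
p≤q+r⇒p-r≤q {p} {q} {r} p≤q+r =
  ℚ.≤-trans (ℚ.+-monoˡ-≤ (ℚ.- r) p≤q+r) (ℚ.≤-reflexive q+r-r≡q)
  where
  q+r-r≡q : q +ℚ r - r ≡ q
  q+r-r≡q = trans (ℚ.+-assoc q r (ℚ.- r))
                  (trans (cong (q +ℚ_) (ℚ.+-inverseʳ r)) (ℚ.+-identityʳ q))

module _ {ε t : ℚ} {k : ℕ} .{{_ : NonZero k}} where

  threshold-nonNeg : 0ℚ ≤ℚ t → 0ℚ <ℚ ε → ofℕ 0 ≤ℚ threshold ε t k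
  threshold-nonNeg 0≤t 0<ε =
    ℚ.nonNegative⁻¹ (threshold ε t k) {{ℚ.nonNeg*nonNeg⇒nonNeg (ε * t) _}}
    where
    instance
      _ = m*n≢0 k k
      _ = ℚ.normalize-nonNeg 1 (k *ℕ k)
      _ = ℚ.pos⇒nonNeg ε {{ℚ.positive 0<ε}}
      _ = ℚ.nonNegative 0≤t
      εt≥0 : NonNegative (ε * t)
      εt≥0 = ℚ.nonNeg*nonNeg⇒nonNeg ε t

  k*[k*c]≤ε*t : ∀ {c} → ofℕ c ≤ℚ threshold ε t k → ofℕ (k *ℕ (k *ℕ c)) ≤ℚ ε * t
  k*[k*c]≤ε*t {c} c≤threshold = begin
    ofℕ (k *ℕ (k *ℕ c))              ≡⟨ cong ofℕ (*-assoc k k c) ⟨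
    ofℕ (k *ℕ k *ℕ c)                ≡⟨ ofℕ-* (k *ℕ k) c ⟩
    ofℕ (k *ℕ k) * ofℕ c             ≤⟨ ℚ.*-monoˡ-≤-nonNeg (ofℕ (k *ℕ k)) c≤threshold ⟩
    ofℕ (k *ℕ k) * threshold ε t k   ≡⟨ ℚ.*-comm (ofℕ (k *ℕ k)) _ ⟩
    ε * t * 1/k² * ofℕ (k *ℕ k)      ≡⟨ ℚ.*-assoc (ε * t) 1/k² _ ⟩
    ε * t * (1/k² * ofℕ (k *ℕ k))    ≡⟨ cong (ε * t *_) 1/k²*k²≡1 ⟩
    ε * t * 1ℚ                       ≡⟨ ℚ.*-identityʳ (ε * t) ⟩
    ε * t                            ∎
    where
    open ℚ.≤-Reasoning
    instance
      _ = m*n≢0 k k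
      _ = ℚ.normalize-nonNeg (k *ℕ k) 1
    1/k² : ℚ
    1/k² = (+ 1) ℚ./ (k *ℕ k)
    1/k²*k²≡1 : 1/k² * ofℕ (k *ℕ k) ≡ 1ℚ
    1/k²*k²≡1 = trans (ℚ.*-comm 1/k² _) (ofℕ*1/n≡1 (k *ℕ k))

∧-true : ∀ a {b} → a ∧ b ≡ true → a ≡ true × b ≡ true
∧-true true {true} refl = refl , refl

∧-mono : ∀ {a a′ b b′} → (a ≡ true → a′ ≡ true) → (b ≡ true → b′ ≡ true) →
         a ∧ b ≡ true → a′ ∧ b′ ≡ true
∧-mono {a} f g ab with ∧-true a ab
... | a≡true , b≡true rewrite f a≡true | g b≡true = refl

count≡0 : ∀ {n} {p : Fin n → Bool} → (∀ i → p i ≢ true) → count p ≡ 0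
count≡0 {zero}      none = refl
count≡0 {suc n} {p} none with p fz in eq
... | true  = ⊥-elim (none fz eq)
... | false = count≡0 (none ∘ fs)

count-mono : ∀ {n} {p q : Fin n → Bool} → (∀ i → p i ≡ true → q i ≡ true) →
             count p ≤ count q
count-mono {zero}          p⇒q = z≤n
count-mono {suc n} {p} {q} p⇒q with p fz in eq | q fz in eq′
... | false | false = count-mono (p⇒q ∘ fs)
... | false | true  = ≤-trans (count-mono (p⇒q ∘ fs)) (m≤n+m _ 1)
... | true  | false with () ← trans (sym (p⇒q fz eq)) eq′
... | true  | true  = +-monoʳ-≤ 1 (count-mono (p⇒q ∘ fs))

count-∨+count-∧ : ∀ {n} (p q : Fin n → Bool) →
                  count (λ i → p i ∨ q i) + count (λ i → p i ∧ q i) ≡ count p + count q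
count-∨+count-∧ {zero}  p q = refl
count-∨+count-∧ {suc n} p q with p fz | q fz | count-∨+count-∧ (p ∘ fs) (q ∘ fs)
... | false | false | ih = ih
... | true  | false | ih = cong suc ih
... | false | true  | ih = trans (cong suc ih) (sym (+-suc _ _))
... | true  | true  | ih = cong suc (trans (+-suc _ _) (trans (cong suc ih) (sym (+-suc _ _))))

count-∨≤ : ∀ {n} (p q : Fin n → Bool) → count (λ i → p i ∨ q i) ≤ count p + count q
count-∨≤ p q = ≤-trans (m≤m+n _ _) (≤-reflexive (count-∨+count-∧ p q))

sumOver≤count* : ∀ {n} (Y : Fin n → Bool) (f : Fin n → ℕ) {c} →
                 (∀ i → Y i ≡ true → f i ≤ c) → sumOver Y f ≤ count Y *ℕ c
sumOver≤count* {zero}  Y f f≤c = z≤n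
sumOver≤count* {suc n} Y f f≤c with Y fz in eq
... | true  = +-mono-≤ (f≤c fz eq) (sumOver≤count* (Y ∘ fs) (f ∘ fs) (f≤c ∘ fs))
... | false = sumOver≤count* (Y ∘ fs) (f ∘ fs) (f≤c ∘ fs)

any : ∀ {n} → (Fin n → Bool) → Bool
any {zero}  p = false
any {suc n} p = p fz ∨ any (p ∘ fs)

nbhd : ∀ {r b} → (Fin r → Fin b → Bool) → (Fin r → Bool) → Fin b → Bool
nbhd E Y y = any (λ x → Y x ∧ E x y)

count-∧-nbhd≤sumOver : ∀ {r b} (a : Fin b → Bool) (E : Fin r → Fin b → Bool) (Y : Fin r → Bool) →
                       count (λ y → a y ∧ nbhd E Y y) ≤
                       sumOver Y (λ x → count (λ y → a y ∧ E x y))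
count-∧-nbhd≤sumOver {zero}  a E Y = ≤-reflexive (count≡0 (λ y → (λ ()) ∘ proj₂ ∘ ∧-true (a y)))
count-∧-nbhd≤sumOver {suc r} {b} a E Y with Y fz
... | false = count-∧-nbhd≤sumOver a (E ∘ fs) (Y ∘ fs)
... | true  = begin
    count (λ y → a y ∧ (E fz y ∨ rest y))
  ≤⟨ count-mono (λ y → trans (sym (∧-distribˡ-∨ (a y) _ _))) ⟩
    count (λ y → (a y ∧ E fz y) ∨ (a y ∧ rest y))
  ≤⟨ count-∨≤ (λ y → a y ∧ E fz y) (λ y → a y ∧ rest y) ⟩
    count (λ y → a y ∧ E fz y) + count (λ y → a y ∧ rest y)
  ≤⟨ +-monoʳ-≤ _ (count-∧-nbhd≤sumOver a (E ∘ fs) (Y ∘ fs)) ⟩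
    count (λ y → a y ∧ E fz y) + sumOver (Y ∘ fs) (λ x → count (λ y → a y ∧ E (fs x) y))
  ∎
  where
  open ≤-Reasoning
  rest : Fin b → Bool
  rest = nbhd (E ∘ fs) (Y ∘ fs)

-- nbhdSize counts with a helper hidden in its where-block; at b = 1 it is the
-- indicator of that helper, which identifies the helper with any.
nbhdSize-column : ∀ {r} (p : Fin r → Bool) →
                  nbhdSize {r} {1} (λ x _ → p x) (λ _ → true) ≡ (if any p then 1 else 0) + 0
nbhdSize-column {zero}  p = refl
nbhdSize-column {suc r} p with p fz
... | true  = refl
... | false = nbhdSize-column (p ∘ fs)

nbhdSize≡count-nbhd : ∀ {r b} (E : Fin r → Fin b → Bool) (Y : Fin r → Bool) →
                      nbhdSize E Y ≡ count (nbhd E Y)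
nbhdSize≡count-nbhd {r} {zero}  E Y = refl
nbhdSize≡count-nbhd {r} {suc b} E Y =
  cong₂ _+_ (trans (sym (+-identityʳ _))
                   (trans (nbhdSize-column (λ x → Y x ∧ E x fz)) (+-identityʳ _)))
            (nbhdSize≡count-nbhd (λ x y → E x (fs y)) Y)

any-mono : ∀ {n} {p q : Fin n → Bool} → (∀ i → p i ≡ true → q i ≡ true) →
           any p ≡ true → any q ≡ true
any-mono {suc n} {p} {q} p⇒q any-p with p fz in eq
... | true  rewrite p⇒q fz eq = refl
... | false with q fz
...   | true  = refl
...   | false = any-mono (p⇒q ∘ fs) any-p

nbhdSize-mono : ∀ {r b} {S E : Fin r → Fin b → Bool} → (∀ x y → S x y ≡ true → E x y ≡ true) →
                (Y : Fin r → Bool) → nbhdSize S Y ≤ nbhdSize E Y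
nbhdSize-mono {S = S} {E} S⊆E Y = begin
  nbhdSize S Y       ≡⟨ nbhdSize≡count-nbhd S Y ⟩
  count (nbhd S Y)   ≤⟨ count-mono (λ y → any-mono (λ x → ∧-mono (λ Yx → Yx) (S⊆E x y))) ⟩
  count (nbhd E Y)   ≡⟨ nbhdSize≡count-nbhd E Y ⟨
  nbhdSize E Y       ∎
  where open ≤-Reasoning

AlmostDisjoint : ∀ {r b} → (Fin r → Fin b → Bool) → (Fin r → Bool) → ℕ → Set
AlmostDisjoint S Y c = ∀ x x′ → x ≢ x′ → Y x ≡ true → Y x′ ≡ true → commonNbrs S x x′ ≤ c

AlmostDisjoint-tail : ∀ {r b} {S : Fin (suc r) → Fin b → Bool} {Y c} →
                      AlmostDisjoint S Y c → AlmostDisjoint (S ∘ fs) (Y ∘ fs) c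
AlmostDisjoint-tail disjoint x x′ x≢x′ = disjoint (fs x) (fs x′) (x≢x′ ∘ suc-injective)

add-vertex : ∀ {b} (s R : Fin b → Bool) (m c σ : ℕ) →
             σ ≤ count R + m *ℕ (m *ℕ c) → count (λ y → s y ∧ R y) ≤ m *ℕ c →
             count s + σ ≤ count (λ y → s y ∨ R y) + suc m *ℕ (suc m *ℕ c)
add-vertex {b} s R m c σ σ≤ overlap≤ = begin
    count s + σ
  ≤⟨ +-monoʳ-≤ (count s) σ≤ ⟩
    count s + (count R + m *ℕ (m *ℕ c))
  ≡⟨ +-assoc (count s) (count R) _ ⟨
    count s + count R + m *ℕ (m *ℕ c)
  ≡⟨ cong (_+ m *ℕ (m *ℕ c)) (count-∨+count-∧ s R) ⟨
    count s∨R + count (λ y → s y ∧ R y) + m *ℕ (m *ℕ c)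
  ≤⟨ +-monoˡ-≤ _ (+-monoʳ-≤ (count s∨R) overlap≤) ⟩
    count s∨R + m *ℕ c + m *ℕ (m *ℕ c)
  ≡⟨ +-assoc (count s∨R) _ _ ⟩
    count s∨R + (m *ℕ c + m *ℕ (m *ℕ c))
  ≤⟨ +-monoʳ-≤ (count s∨R) (+-mono-≤ (m≤n+m _ c) (*-monoʳ-≤ m (m≤n+m _ c))) ⟩
    count s∨R + (c + m *ℕ c + m *ℕ (c + m *ℕ c))
  ≡⟨⟩
    count s∨R + suc m *ℕ (suc m *ℕ c)
  ∎
  where
  open ≤-Reasoning
  s∨R : Fin b → Bool
  s∨R y = s y ∨ R y

sumOver-deg≤count-nbhd : ∀ {r b} (S : Fin r → Fin b → Bool) (Y : Fin r → Bool) {c} →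
                         AlmostDisjoint S Y c →
                         sumOver Y (deg S) ≤ count (nbhd S Y) + count Y *ℕ (count Y *ℕ c)
sumOver-deg≤count-nbhd {zero}  S Y disjoint = z≤n
sumOver-deg≤count-nbhd {suc r} S Y {c} disjoint with Y fz in Y₀
... | false = sumOver-deg≤count-nbhd (S ∘ fs) (Y ∘ fs) (AlmostDisjoint-tail {S = S} disjoint)
... | true  = add-vertex (S fz) (nbhd (S ∘ fs) (Y ∘ fs)) (count (Y ∘ fs)) c _
  (sumOver-deg≤count-nbhd (S ∘ fs) (Y ∘ fs) (AlmostDisjoint-tail {S = S} disjoint))
  (≤-trans (count-∧-nbhd≤sumOver (S fz) (S ∘ fs) (Y ∘ fs))
           (sumOver≤count* (Y ∘ fs) _ (λ x → disjoint fz (fs x) (λ ()) Y₀)))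

sumOver-deg≤nbhdSize : ∀ {r b} (S : Fin r → Fin b → Bool) (Y : Fin r → Bool) {c} →
                       AlmostDisjoint S Y c →
                       sumOver Y (deg S) ≤ nbhdSize S Y + count Y *ℕ (count Y *ℕ c)
sumOver-deg≤nbhdSize S Y disjoint =
  subst (λ n → sumOver Y (deg S) ≤ n + _) (sym (nbhdSize≡count-nbhd S Y))
        (sumOver-deg≤count-nbhd S Y disjoint)

maxOver : ∀ {n} → (Fin n → ℕ) → ℕ
maxOver {zero}  f = 0
maxOver {suc n} f = f fz ⊔ maxOver (f ∘ fs)

≤-maxOver : ∀ {n} (f : Fin n → ℕ) i → f i ≤ maxOver f
≤-maxOver f fz     = m≤m⊔n (f fz) _
≤-maxOver f (fs i) = ≤-trans (≤-maxOver (f ∘ fs) i) (m≤n⊔m (f fz) _)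

maxOver-closed : (Q : ℕ → Set) → Q 0 → ∀ {n} (f : Fin n → ℕ) → (∀ i → Q (f i)) → Q (maxOver f)
maxOver-closed Q Q0 {zero}  f Qf = Q0
maxOver-closed Q Q0 {suc n} f Qf with ⊔-sel (f fz) (maxOver (f ∘ fs))
... | inj₁ eq = subst Q (sym eq) (Qf fz)
... | inj₂ eq = subst Q (sym eq) (maxOver-closed Q Q0 (f ∘ fs) (Qf ∘ fs))

maxOffDiagonal : ∀ {n} → (Fin n → Fin n → ℕ) → ℕ
maxOffDiagonal f = maxOver (λ x → maxOver (λ x′ → if does (x ≟ x′) then 0 else f x x′))

≤-maxOffDiagonal : ∀ {n} (f : Fin n → Fin n → ℕ) {x x′} → x ≢ x′ → f x x′ ≤ maxOffDiagonal f
≤-maxOffDiagonal f {x} {x′} x≢x′ = ≤-trans entry≤ (≤-trans (≤-maxOver _ x′) (≤-maxOver _ x))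
  where
  entry≤ : f x x′ ≤ (if does (x ≟ x′) then 0 else f x x′)
  entry≤ rewrite dec-false (x ≟ x′) x≢x′ = ≤-refl

maxOffDiagonal-closed : (Q : ℕ → Set) → Q 0 → ∀ {n} (f : Fin n → Fin n → ℕ) →
                        (∀ x x′ → x ≢ x′ → Q (f x x′)) → Q (maxOffDiagonal f)
maxOffDiagonal-closed Q Q0 f Qf =
  maxOver-closed Q Q0 _ (λ x → maxOver-closed Q Q0 _ (λ x′ → entry x x′))
  where
  entry : ∀ x x′ → Q (if does (x ≟ x′) then 0 else f x x′)
  entry x x′ with x ≟ x′
  ... | yes _    = Q0
  ... | no x≢x′ = Qf x x′ x≢x′

module _ {r b} {E S : Fin r → Fin b → Bool} {ε t : ℚ} {k : ℕ} .{{_ : NonZero k}}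
         {P : Fin r → Bool} (spar : IsSpar E ε t k P S) where

  private
    S⊆E : ∀ x y → S x y ≡ true → E x y ≡ true
    S⊆E = proj₁ spar
    S-purple : ∀ x y → S x y ≡ true → Purple E ε t k P x
    S-purple = proj₁ (proj₂ spar)

  conflict⇒no-common-spar-nbr : ∀ {x x′} → ConfEdge E ε t k x x′ → ∀ y → S x y ∧ S x′ y ≢ true
  conflict⇒no-common-spar-nbr {x} {x′} conflict@(x≢x′ , _) y Sxy∧Sx′y =
    x≢x′ (proj₂ (proj₂ (proj₂ spar) y x x-purple (x , x~x , S⊆E x y Sxy)) x x′ x~x x~x′ Sxy Sx′y)
    where
    Sxy : S x y ≡ true
    Sxy = proj₁ (∧-true (S x y) Sxy∧Sx′y)
    Sx′y : S x′ y ≡ true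
    Sx′y = proj₂ (∧-true (S x y) Sxy∧Sx′y)
    x-purple : Purple E ε t k P x
    x-purple = S-purple x y Sxy
    x~x : SameComp E ε t k P x x
    x~x = here (proj₁ x-purple)
    x~x′ : SameComp E ε t k P x x′
    x~x′ = step x~x (proj₁ (S-purple x′ y Sx′y)) conflict

  commonNbrs-spar≤threshold : 0ℚ ≤ℚ t → 0ℚ <ℚ ε → ∀ x x′ → x ≢ x′ →
                              ofℕ (commonNbrs S x x′) ≤ℚ threshold ε t k
  commonNbrs-spar≤threshold 0≤t 0<ε x x′ x≢x′
    with threshold ε t k ℚ.≤? ofℕ (commonNbrs E x x′)
  ... | yes conflict =
    subst (λ n → ofℕ n ≤ℚ threshold ε t k)
          (sym (count≡0 (conflict⇒no-common-spar-nbr (x≢x′ , conflict))))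
          (threshold-nonNeg 0≤t 0<ε)
  ... | no no-conflict =
    ℚ.≤-trans (ofℕ-mono-≤ (count-mono (λ y → ∧-mono (S⊆E x y) (S⊆E x′ y))))
              (ℚ.<⇒≤ (ℚ.≰⇒> no-conflict))

lemma5p5 : (r b : ℕ) (E : Fin r → Fin b → Bool) (k : ℕ) .{{_ : NonZero k}}
           (t ε : ℚ) → 0ℚ ≤ℚ t → 0ℚ <ℚ ε → (P : Fin r → Bool)
           (S : Fin r → Fin b → Bool) → IsSpar E ε t k P S →
           (Y : Fin r → Bool) → (∀ y → Y y ≡ true → Purple E ε t k P y) →
           count Y ≤ k →
           (nbhdSize E Y ≥ nbhdSize S Y) ×
           (ofℕ (sumOver Y (deg S)) - ε * t ≤ℚ ofℕ (nbhdSize S Y))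
lemma5p5 r b E k t ε 0≤t 0<ε P S spar Y _ |Y|≤k =
  nbhdSize-mono (proj₁ spar) Y , p≤q+r⇒p-r≤q (begin
    ofℕ (sumOver Y (deg S))
  ≤⟨ ofℕ-mono-≤ degree-sum≤ ⟩
    ofℕ (nbhdSize S Y + k *ℕ (k *ℕ c))
  ≡⟨ ofℕ-+ (nbhdSize S Y) _ ⟩
    ofℕ (nbhdSize S Y) +ℚ ofℕ (k *ℕ (k *ℕ c))
  ≤⟨ ℚ.+-monoʳ-≤ (ofℕ (nbhdSize S Y)) (k*[k*c]≤ε*t {ε} {t} c≤threshold) ⟩
    ofℕ (nbhdSize S Y) +ℚ ε * t
  ∎)
  where
  open ℚ.≤-Reasoning
  c : ℕ
  c = maxOffDiagonal (commonNbrs S)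
  c≤threshold : ofℕ c ≤ℚ threshold ε t k
  c≤threshold = maxOffDiagonal-closed (λ n → ofℕ n ≤ℚ threshold ε t k) (threshold-nonNeg 0≤t 0<ε)
                  (commonNbrs S) (commonNbrs-spar≤threshold spar 0≤t 0<ε)
  disjoint : AlmostDisjoint S Y c
  disjoint x x′ x≢x′ _ _ = ≤-maxOffDiagonal (commonNbrs S) x≢x′
  degree-sum≤ : sumOver Y (deg S) ≤ nbhdSize S Y + k *ℕ (k *ℕ c)
  degree-sum≤ = ≤-trans (sumOver-deg≤nbhdSize S Y disjoint)
                        (+-monoʳ-≤ (nbhdSize S Y) (*-mono-≤ |Y|≤k (*-monoˡ-≤ c |Y|≤k)))
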